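{- Let $n\ge 1$ and let $N$ be an integer with $2^n-1\le N\le 2^{n+1}-2$, and write the binary expansion of $N+1$ as $a_n a_{n-1}\cdots a_1 a_0$ with $a_n=1$. In unlabeled chip-firing on the infinite binary tree with a self-loop at the root, starting with $N$ chips at the root, the terminal configuration has exactly $a_i+1$ chips at each node on level $i+1$, for every $0\le i\le n-1$.
   Context: The infinite binary tree has nodes labeled by positive integers: node $1$ is the root, node $i$ has children $2i$ and $2i+1$ and (for $i>1$) parent $\lfloor i/2\rfloor$. A self-loop is added at the root, so every node has degree $3$. The level of node $i$ is $\lfloor\log_2 i\rfloor+1$. Unlabeled chip-firing: a node with at least $3$ (indistinguishable) chips may fire, sending one chip to each of its two children and one to its parent (the root sends this chip to itself). A configuration is terminal if no node has $3$ or more chips; the process terminates in a unique terminal configuration. -}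

module Defs where

open import Data.Nat using (ℕ; zero; suc; _+_; _*_; _^_; _≤_; _<_; _/_; _%_; _≟_)
open import Data.Product using (Σ; _×_; ∃; _,_)
open import Relation.Nullary using (Dec; yes; no)
open import Relation.Binary.PropositionalEquality using (_≡_)
open import Relation.Binary.Construct.Closure.ReflexiveTransitive using (Star)

-- Nodes of the infinite binary tree are the positive integers; label 0 is unused.
-- A configuration assigns a number of (indistinguishable) chips to every label.
Config : Set
Config = ℕ → ℕ

parent : ℕ → ℕ
parent 1 = 1
parent v = v / 2

[_≟'_] : ℕ → ℕ → ℕ
[ a ≟' b ] with a ≟ b
... | yes _ = 1
... | no  _ = 0

gain : ℕ → ℕ → ℕ
gain v w = [ w ≟' 2 * v ] + [ w ≟' suc (2 * v) ] + [ w ≟' parent v ]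

Fire : Config → Config → Set
Fire c c' = Σ ℕ λ v → (1 ≤ v) × (3 ≤ c v) ×
  (∀ w → c' w + 3 * [ w ≟' v ] ≡ c w + gain v w)

Reach : Config → Config → Set
Reach = Star Fire

Terminal : Config → Set
Terminal c = ∀ w → 1 ≤ w → c w < 3

atRoot : ℕ → Config
atRoot N w = [ w ≟' 1 ] * N

bit : ℕ → ℕ → ℕ
bit m zero    = m % 2
bit m (suc i) = bit (m / 2) i

-- node w lies on level i+1, i.e. ⌊log₂ w⌋ = i
OnLevelSuc : ℕ → ℕ → Set
OnLevelSuc i w = (2 ^ i ≤ w) × (w < 2 ^ suc i)

-- Chip-firing is abelian: a firing sequence from c₀ to c is summarised by its odometer f (how
-- often each node fired), and c = c₀ + (chips received under f) − 3 f. If some sequence reaches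
-- a terminal t with odometer F, every firing sequence from c₀ has odometer at most F, so two
-- terminal configurations reached from c₀ have equal odometers and coincide.
--
-- The terminal configuration for N chips at the root is constant on levels. Firing every node
-- of a level is a single move on level profiles, and one more chip at the root of the terminal
-- profile for N − 1 chips increments N in binary: level j holds 1 + (bit j of N) chips per node
-- once 2 ^ (j + 1) ≤ N. A level reaching 3 chips per node fires; the chips it sends towards the
-- root make the levels in between (one chip each) fire in turn, and one chip per node is carried
-- to the next level away from the root.

module Submission where

open import Defs
open import Data.Nat using (ℕ; zero; suc; _+_; _*_; _∸_; _^_; _≤_; _<_; _/_; _%_; _≟_; _<?_; z≤n; s≤s; ⌊_/2⌋; pred; >-nonZero)
open import Data.Nat.Properties
open import Data.Nat.DivMod using (m/n≡1+[m∸n]/n; m*n/n≡m; m*n%n≡0; [m+kn]%n≡m%n; m%n<n; m<n*o⇒m/o<n; m≥n⇒m/n>0; /-monoˡ-≤)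
open import Data.Nat.Logarithm using (⌊log₂_⌋; ⌊log₂⌋-mono-≤; ⌊log₂⌊n/2⌋⌋≡⌊log₂n⌋∸1; ⌊log₂[2*b]⌋≡1+⌊log₂b⌋; ⌊log₂[2^n]⌋≡n)
open import Data.Nat.Induction using (<-wellFounded)
open import Data.Nat.Tactic.RingSolver using (solve-∀)
open import Data.List using (List; []; _∷_)
open import Data.Product using (Σ; _×_; _,_)
open import Data.Empty using (⊥-elim)
open import Relation.Nullary using (¬_; yes; no)
open import Relation.Binary.PropositionalEquality
open import Relation.Binary.Construct.Closure.ReflexiveTransitive using (Star; ε; _◅_; _◅◅_)
open import Induction.WellFounded using (Acc; acc)

≡⇒ind≡1 : ∀ {a b} → a ≡ b → [ a ≟' b ] ≡ 1
≡⇒ind≡1 {a} {b} a≡b with a ≟ b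
... | yes _   = refl
... | no a≢b = ⊥-elim (a≢b a≡b)

≢⇒ind≡0 : ∀ {a b} → ¬ a ≡ b → [ a ≟' b ] ≡ 0
≢⇒ind≡0 {a} {b} a≢b with a ≟ b
... | yes a≡b = ⊥-elim (a≢b a≡b)
... | no _    = refl

ind-cong : ∀ {a b c d} → (a ≡ b → c ≡ d) → (c ≡ d → a ≡ b) → [ a ≟' b ] ≡ [ c ≟' d ]
ind-cong {a} {b} to from with a ≟ b
... | yes a≡b = sym (≡⇒ind≡1 (to a≡b))
... | no a≢b  = sym (≢⇒ind≡0 (λ c≡d → a≢b (from c≡d)))

ind-sym : ∀ a b → [ a ≟' b ] ≡ [ b ≟' a ]
ind-sym a b = ind-cong sym sym

ind-suc : ∀ a b → [ suc a ≟' suc b ] ≡ [ a ≟' b ]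
ind-suc a b = ind-cong suc-injective (cong suc)

ind≤1 : ∀ a b → [ a ≟' b ] ≤ 1
ind≤1 a b with a ≟ b
... | yes _ = s≤s z≤n
... | no _  = z≤n

ind>0⇒≡ : ∀ {a b} → 1 ≤ [ a ≟' b ] → a ≡ b
ind>0⇒≡ {a} {b} pos with a ≟ b
... | yes a≡b = a≡b
ind>0⇒≡ {a} {b} () | no _

[2+n]/2≡1+n/2 : ∀ n → suc (suc n) / 2 ≡ suc (n / 2)
[2+n]/2≡1+n/2 n = m/n≡1+[m∸n]/n {suc (suc n)} {2} (s≤s (s≤s z≤n))

[2*n]/2≡n : ∀ n → 2 * n / 2 ≡ n
[2*n]/2≡n n = trans (cong (_/ 2) (*-comm 2 n)) (m*n/n≡m n 2)

[1+2*n]/2≡n : ∀ n → suc (2 * n) / 2 ≡ n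
[1+2*n]/2≡n zero    = refl
[1+2*n]/2≡n (suc n) = begin
  suc (2 * suc n) / 2   ≡⟨ cong (λ m → suc m / 2) (*-suc 2 n) ⟩
  suc (suc (suc (2 * n))) / 2 ≡⟨ [2+n]/2≡1+n/2 (suc (2 * n)) ⟩
  suc (suc (2 * n) / 2) ≡⟨ cong suc ([1+2*n]/2≡n n) ⟩
  suc n                 ∎
  where open ≡-Reasoning

data EvenOdd : ℕ → Set where
  even : ∀ q → EvenOdd (2 * q)
  odd  : ∀ q → EvenOdd (suc (2 * q))

evenOdd : ∀ n → EvenOdd n
evenOdd zero = even 0
evenOdd (suc n) with evenOdd n
... | even q = odd q
... | odd q  = subst EvenOdd (*-suc 2 q) (even (suc q))

ind-/2 : ∀ a b → [ a / 2 ≟' b ] ≡ [ a ≟' 2 * b ] + [ a ≟' suc (2 * b) ]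
ind-/2 a b with evenOdd a
ind-/2 .(2 * q) b | even q
  rewrite [2*n]/2≡n q | ≢⇒ind≡0 (even≢odd q b) | +-identityʳ [ 2 * q ≟' 2 * b ]
  = ind-cong (cong (2 *_)) (*-cancelˡ-≡ q b 2)
ind-/2 .(suc (2 * q)) b | odd q
  rewrite [1+2*n]/2≡n q | ≢⇒ind≡0 (λ e → even≢odd b q (sym e))
  = ind-cong (cong (λ x → suc (2 * x))) (λ e → *-cancelˡ-≡ q b 2 (suc-injective e))

-- Odometers and uniqueness of the terminal configuration

_≤ᶠ_ : (ℕ → ℕ) → (ℕ → ℕ) → Set
f ≤ᶠ g = ∀ u → f u ≤ g u

received : (ℕ → ℕ) → ℕ → ℕ
received f zero    = 0
received f (suc w) = f (parent (suc w)) + f (2 * suc w) + f (suc (2 * suc w))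

received-+ : ∀ f g w → received (λ v → f v + g v) w ≡ received f w + received g w
received-+ f g zero    = refl
received-+ f g (suc w) = shuffle (f _) (g _) (f _) (g _) (f _) (g _)
  where
  shuffle : ∀ a b c d e h → a + b + (c + d) + (e + h) ≡ a + c + e + (b + d + h)
  shuffle = solve-∀

received-mono : ∀ {f g} → f ≤ᶠ g → ∀ w → received f w ≤ received g w
received-mono f≤g zero    = z≤n
received-mono f≤g (suc w) = +-mono-≤ (+-mono-≤ (f≤g _) (f≤g _)) (f≤g _)

received-cong : ∀ {f g} → f ≗ g → received f ≗ received g
received-cong f≗g zero    = refl
received-cong f≗g (suc w) = cong₂ _+_ (cong₂ _+_ (f≗g _) (f≗g _)) (f≗g _)

received-0 : received (λ _ → 0) ≗ (λ _ → 0)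
received-0 zero    = refl
received-0 (suc w) = refl

ind-children : ∀ a b → [ 2 * a ≟' b ] + [ suc (2 * a) ≟' b ] ≡ [ a ≟' b / 2 ]
ind-children a b = begin
  [ 2 * a ≟' b ] + [ suc (2 * a) ≟' b ] ≡⟨ cong₂ _+_ (ind-sym (2 * a) b) (ind-sym (suc (2 * a)) b) ⟩
  [ b ≟' 2 * a ] + [ b ≟' suc (2 * a) ] ≡⟨ ind-/2 b a ⟨
  [ b / 2 ≟' a ]                        ≡⟨ ind-sym (b / 2) a ⟩
  [ a ≟' b / 2 ]                        ∎
  where open ≡-Reasoning

received-ind≡gain : ∀ v → 1 ≤ v → received (λ u → [ u ≟' v ]) ≗ gain v
received-ind≡gain (suc zero)    _ zero = refl
received-ind≡gain (suc (suc v)) _ zero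
  rewrite [2+n]/2≡1+n/2 v = refl
received-ind≡gain (suc zero)    _ (suc zero) = refl
received-ind≡gain (suc (suc v)) _ (suc zero) = ind-children 1 (suc (suc v))
received-ind≡gain (suc zero)    _ (suc (suc w)) = begin
  [ W / 2 ≟' 1 ] + 0 + 0                   ≡⟨ +-identityʳ _ ⟩
  [ W / 2 ≟' 1 ] + 0                       ≡⟨ +-identityʳ _ ⟩
  [ W / 2 ≟' 1 ]                           ≡⟨ ind-/2 W 1 ⟩
  [ W ≟' 2 ] + [ W ≟' 3 ]                  ≡⟨ +-identityʳ _ ⟨
  [ W ≟' 2 ] + [ W ≟' 3 ] + 0              ∎
  where
  open ≡-Reasoning
  W = suc (suc w)
received-ind≡gain (suc (suc v)) _ (suc (suc w)) = begin
  [ W / 2 ≟' V ] + [ 2 * W ≟' V ] + [ suc (2 * W) ≟' V ]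
    ≡⟨ +-assoc [ W / 2 ≟' V ] _ _ ⟩
  [ W / 2 ≟' V ] + ([ 2 * W ≟' V ] + [ suc (2 * W) ≟' V ])
    ≡⟨ cong₂ _+_ (ind-/2 W V) (ind-children W V) ⟩
  [ W ≟' 2 * V ] + [ W ≟' suc (2 * V) ] + [ W ≟' V / 2 ] ∎
  where
  open ≡-Reasoning
  W = suc (suc w)
  V = suc (suc v)

-- c = c₀ + received f − 3 f, stated without truncated subtraction
Odometer : Config → (ℕ → ℕ) → Config → Set
Odometer c₀ f c = ∀ w → c w + 3 * f w ≡ c₀ w + received f w

odometer-0 : ∀ c → Odometer c (λ _ → 0) c
odometer-0 c w = begin
  c w + 0                   ≡⟨ +-identityʳ (c w) ⟩
  c w                       ≡⟨ +-identityʳ (c w) ⟨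
  c w + 0                   ≡⟨ cong (c w +_) (received-0 w) ⟨
  c w + received (λ _ → 0) w ∎
  where open ≡-Reasoning

tick : ℕ → (ℕ → ℕ) → ℕ → ℕ
tick v f u = [ u ≟' v ] + f u

fire-odometer : ∀ {c₀ f c c'} → ((v , _) : Fire c c') → Odometer c₀ f c → Odometer c₀ (tick v f) c'
fire-odometer {c₀} {f} {c} {c'} (v , 1≤v , _ , fired) odo w = begin
  c' w + 3 * ([ w ≟' v ] + f w)                     ≡⟨ shuffle₁ (c' w) [ w ≟' v ] (f w) ⟩
  (c' w + 3 * [ w ≟' v ]) + 3 * f w                 ≡⟨ cong (_+ 3 * f w) (fired w) ⟩
  c w + gain v w + 3 * f w                          ≡⟨ shuffle₂ (c w) (gain v w) (3 * f w) ⟩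
  (c w + 3 * f w) + gain v w                        ≡⟨ cong (_+ gain v w) (odo w) ⟩
  c₀ w + received f w + gain v w                    ≡⟨ cong (λ g → c₀ w + received f w + g) (received-ind≡gain v 1≤v w) ⟨
  c₀ w + received f w + received (λ u → [ u ≟' v ]) w ≡⟨ shuffle₃ (c₀ w) _ _ ⟩
  c₀ w + (received (λ u → [ u ≟' v ]) w + received f w) ≡⟨ cong (c₀ w +_) (received-+ (λ u → [ u ≟' v ]) f w) ⟨
  c₀ w + received (tick v f) w                      ∎
  where
  open ≡-Reasoning
  shuffle₁ : ∀ a b d → a + 3 * (b + d) ≡ a + 3 * b + 3 * d
  shuffle₁ = solve-∀
  shuffle₂ : ∀ a b d → a + b + d ≡ a + d + b
  shuffle₂ = solve-∀
  shuffle₃ : ∀ a b d → a + b + d ≡ a + (d + b)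
  shuffle₃ = solve-∀

odometerAfter : ∀ {c d} → (ℕ → ℕ) → Reach c d → ℕ → ℕ
odometerAfter f ε             = f
odometerAfter f ((v , _) ◅ r) = odometerAfter (tick v f) r

reach-odometer : ∀ {c₀ f c d} (r : Reach c d) → Odometer c₀ f c → Odometer c₀ (odometerAfter f r) d
reach-odometer ε         odo = odo
reach-odometer (_◅_ {j = c'} φ r) odo = reach-odometer r (fire-odometer {c' = c'} φ odo)

-- A node v with h v ≡ F v and at least 3 chips would keep at least 3 chips in t.
least-action : ∀ {c₀ t F} → Odometer c₀ F t → Terminal t →
  ∀ {c d h} (r : Reach c d) → Odometer c₀ h c → h ≤ᶠ F → odometerAfter h r ≤ᶠ F
least-action odoF t-terminal ε _ h≤F = h≤F
least-action {c₀} {t} {F} odoF t-terminal {c} {h = h} (_◅_ {j = c'} φ@(v , 1≤v , 3≤cv , _) r) odo h≤F =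
  least-action odoF t-terminal r (fire-odometer {c' = c'} φ odo) tick≤F
  where
  saturated⇒c≤t : h v ≡ F v → c v ≤ t v
  saturated⇒c≤t hv≡Fv = +-cancelʳ-≤ (3 * F v) (c v) (t v) (begin
    c v + 3 * F v      ≡⟨ cong (λ x → c v + 3 * x) hv≡Fv ⟨
    c v + 3 * h v      ≡⟨ odo v ⟩
    c₀ v + received h v ≤⟨ +-monoʳ-≤ (c₀ v) (received-mono h≤F v) ⟩
    c₀ v + received F v ≡⟨ odoF v ⟨
    t v + 3 * F v      ∎)
    where open ≤-Reasoning
  hv<Fv : h v < F v
  hv<Fv with h v <? F v
  ... | yes hv<Fv = hv<Fv
  ... | no hv≮Fv  = ⊥-elim (<⇒≱ (t-terminal v 1≤v)
                      (≤-trans 3≤cv (saturated⇒c≤t (≤-antisym (h≤F v) (≮⇒≥ hv≮Fv)))))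
  tick≤F : tick v h ≤ᶠ F
  tick≤F u with u ≟ v
  ... | yes refl = hv<Fv
  ... | no _     = h≤F u

terminal-unique : ∀ {c₀ t₁ t₂} → Reach c₀ t₁ → Terminal t₁ → Reach c₀ t₂ → Terminal t₂ → t₁ ≗ t₂
terminal-unique {c₀} {t₁} {t₂} r₁ terminal₁ r₂ terminal₂ w =
  +-cancelʳ-≡ (3 * F₁ w) (t₁ w) (t₂ w) (begin
    t₁ w + 3 * F₁ w      ≡⟨ odo₁ w ⟩
    c₀ w + received F₁ w ≡⟨ cong (c₀ w +_) (received-cong F₁≗F₂ w) ⟩
    c₀ w + received F₂ w ≡⟨ odo₂ w ⟨
    t₂ w + 3 * F₂ w      ≡⟨ cong (λ x → t₂ w + 3 * x) (F₁≗F₂ w) ⟨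
    t₂ w + 3 * F₁ w      ∎)
  where
  open ≡-Reasoning
  F₁ F₂ : ℕ → ℕ
  F₁ = odometerAfter (λ _ → 0) r₁
  F₂ = odometerAfter (λ _ → 0) r₂
  odo₁ : Odometer c₀ F₁ t₁
  odo₁ = reach-odometer r₁ (odometer-0 c₀)
  odo₂ : Odometer c₀ F₂ t₂
  odo₂ = reach-odometer r₂ (odometer-0 c₀)
  F₁≗F₂ : F₁ ≗ F₂
  F₁≗F₂ u = ≤-antisym (least-action odo₂ terminal₂ r₁ (odometer-0 c₀) (λ _ → z≤n) u)
                      (least-action odo₁ terminal₁ r₂ (odometer-0 c₀) (λ _ → z≤n) u)

odometer-after-fire : ∀ {c c' g d} → ((v , _) : Fire c c') → Odometer c (tick v g) d → Odometer c' g d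
odometer-after-fire {c} {c'} {g} {d} (v , 1≤v , _ , fired) odo w =
  +-cancelʳ-≡ (3 * [ w ≟' v ]) _ _ (begin
    d w + 3 * g w + 3 * [ w ≟' v ]          ≡⟨ shuffle₁ (d w) (g w) [ w ≟' v ] ⟩
    d w + 3 * ([ w ≟' v ] + g w)            ≡⟨ odo w ⟩
    c w + received (tick v g) w             ≡⟨ cong (c w +_) (received-+ (λ u → [ u ≟' v ]) g w) ⟩
    c w + (received (λ u → [ u ≟' v ]) w + received g w)
                                            ≡⟨ cong (λ x → c w + (x + received g w)) (received-ind≡gain v 1≤v w) ⟩
    c w + (gain v w + received g w)         ≡⟨ +-assoc (c w) _ _ ⟨
    c w + gain v w + received g w           ≡⟨ cong (_+ received g w) (fired w) ⟨
    c' w + 3 * [ w ≟' v ] + received g w    ≡⟨ shuffle₂ (c' w) _ _ ⟩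
    c' w + received g w + 3 * [ w ≟' v ]    ∎)
  where
  open ≡-Reasoning
  shuffle₁ : ∀ a b x → a + 3 * b + 3 * x ≡ a + 3 * (x + b)
  shuffle₁ = solve-∀
  shuffle₂ : ∀ a b x → a + b + x ≡ a + x + b
  shuffle₂ = solve-∀

-- Configurations are functions, so reachability is taken up to pointwise equality.
infix 4 _↠_
_↠_ : Config → Config → Set
c ↠ d = Σ Config λ d' → Reach c d' × d' ≗ d

↠-reflexive : ∀ {c d} → c ≗ d → c ↠ d
↠-reflexive c≗d = _ , ε , c≗d

fire-respˡ : ∀ {c c' d} → c' ≗ c → Fire c d → Fire c' d
fire-respˡ {c} c'≗c (v , 1≤v , 3≤cv , fired) =
  v , 1≤v , subst (3 ≤_) (sym (c'≗c v)) 3≤cv , λ w → trans (fired w) (cong (_+ gain v w) (sym (c'≗c w)))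

reach-respˡ : ∀ {c c' d} → c' ≗ c → Reach c d → c' ↠ d
reach-respˡ c'≗c ε       = ↠-reflexive c'≗c
reach-respˡ c'≗c (_◅_ {j = m} φ r) = _ , fire-respˡ {d = m} c'≗c φ ◅ r , λ _ → refl

↠-trans : ∀ {c d e} → c ↠ d → d ↠ e → c ↠ e
↠-trans (d' , r , d'≗d) (e' , r' , e'≗e) with reach-respˡ d'≗d r'
... | e'' , r'' , e''≗e' = e'' , r ◅◅ r'' , λ w → trans (e''≗e' w) (e'≗e w)

_⊕_ : Config → Config → Config
(c ⊕ e) w = c w + e w

fire-⊕ : ∀ {c d} e → Fire c d → Fire (c ⊕ e) (d ⊕ e)
fire-⊕ {c} {d} e (v , 1≤v , 3≤cv , fired) = v , 1≤v , ≤-trans 3≤cv (m≤m+n (c v) (e v)) , λ w → begin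
  d w + e w + 3 * [ w ≟' v ] ≡⟨ shuffle (d w) (e w) _ ⟩
  d w + 3 * [ w ≟' v ] + e w ≡⟨ cong (_+ e w) (fired w) ⟩
  c w + gain v w + e w       ≡⟨ shuffle (c w) (gain v w) (e w) ⟩
  c w + e w + gain v w       ∎
  where
  open ≡-Reasoning
  shuffle : ∀ a b x → a + b + x ≡ a + x + b
  shuffle = solve-∀

↠-⊕ : ∀ {c d} e → c ↠ d → c ⊕ e ↠ d ⊕ e
↠-⊕ e (d' , r , d'≗d) = d' ⊕ e , reach-⊕ r , λ w → cong (_+ e w) (d'≗d w)
  where
  reach-⊕ : ∀ {c d} → Reach c d → Reach (c ⊕ e) (d ⊕ e)
  reach-⊕ ε                     = ε
  reach-⊕ (_◅_ {j = m} φ r) = fire-⊕ {d = m} e φ ◅ reach-⊕ r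

afterFiring : Config → ℕ → Config
afterFiring c v w = c w + gain v w ∸ 3 * [ w ≟' v ]

fire : ∀ {c v} → 1 ≤ v → 3 ≤ c v → Fire c (afterFiring c v)
fire {c} {v} 1≤v 3≤cv = v , 1≤v , 3≤cv , fired
  where
  fired : ∀ w → afterFiring c v w + 3 * [ w ≟' v ] ≡ c w + gain v w
  fired w with w ≟ v
  ... | yes refl = m∸n+n≡m (≤-trans 3≤cv (m≤m+n (c w) (gain w w)))
  ... | no _     = +-identityʳ _

afterFiring-≥ : ∀ c {v w} → [ w ≟' v ] ≡ 0 → c w ≤ afterFiring c v w
afterFiring-≥ c {v} {w} w≢v =
  subst (λ x → c w ≤ c w + gain v w ∸ 3 * x) (sym w≢v) (m≤m+n (c w) (gain v w))

multiplicity : List ℕ → ℕ → ℕ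
multiplicity []      _ = 0
multiplicity (v ∷ L)   = tick v (multiplicity L)

fire-distinct : ∀ L {c d} → multiplicity L 0 ≡ 0 → (∀ v → multiplicity L v ≤ 1) →
  (∀ v → 1 ≤ multiplicity L v → 3 ≤ c v) → Odometer c (multiplicity L) d → c ↠ d
fire-distinct [] {c} {d} _ _ _ odo = ↠-reflexive λ w → sym (begin
  d w                          ≡⟨ +-identityʳ (d w) ⟨
  d w + 0                      ≡⟨ odo w ⟩
  c w + received (λ _ → 0) w   ≡⟨ cong (c w +_) (received-0 w) ⟩
  c w + 0                      ≡⟨ +-identityʳ (c w) ⟩
  c w                          ∎)
  where open ≡-Reasoning
fire-distinct (zero ∷ L) () _ _ _
fire-distinct (v@(suc _) ∷ L) {c} {d} 0∉vL distinct loaded odo =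
  ↠-trans (_ , fire 1≤v 3≤cv ◅ ε , λ _ → refl)
          (fire-distinct L 0∉L distinctL loadedL (odometer-after-fire {d = d} (fire 1≤v 3≤cv) odo))
  where
  1≤v : 1 ≤ v
  1≤v = s≤s z≤n
  3≤cv : 3 ≤ c v
  3≤cv = loaded v (≤-trans (≤-reflexive (sym (≡⇒ind≡1 {v} refl))) (m≤m+n _ _))
  0∉L : multiplicity L 0 ≡ 0
  0∉L = m+n≡0⇒n≡0 [ 0 ≟' v ] 0∉vL
  distinctL : ∀ u → multiplicity L u ≤ 1
  distinctL u = ≤-trans (m≤n+m _ _) (distinct u)
  loadedL : ∀ u → 1 ≤ multiplicity L u → 3 ≤ afterFiring c v u
  loadedL u u∈L = ≤-trans (loaded u (≤-trans u∈L (m≤n+m _ _))) (afterFiring-≥ c u≢v)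
    where
    u≢v : [ u ≟' v ] ≡ 0
    u≢v = n≤0⇒n≡0 (+-cancelʳ-≤ _ _ 0 (≤-trans (+-monoʳ-≤ [ u ≟' v ] u∈L) (distinct u)))

-- Configurations constant on levels

level : ℕ → ℕ
level w = ⌊log₂ w ⌋

⌊n/2⌋≡n/2 : ∀ n → ⌊ n /2⌋ ≡ n / 2
⌊n/2⌋≡n/2 zero          = refl
⌊n/2⌋≡n/2 (suc zero)    = refl
⌊n/2⌋≡n/2 (suc (suc n)) = trans (cong suc (⌊n/2⌋≡n/2 n)) (sym ([2+n]/2≡1+n/2 n))

level-/2 : ∀ w → level (w / 2) ≡ pred (level w)
level-/2 w = trans (cong level (sym (⌊n/2⌋≡n/2 w))) (⌊log₂⌊n/2⌋⌋≡⌊log₂n⌋∸1 w)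

level≡1+level-/2 : ∀ w → 2 ≤ w → level w ≡ suc (level (w / 2))
level≡1+level-/2 w 2≤w = trans (sym (suc-pred (level w) {{>-nonZero (⌊log₂⌋-mono-≤ {2} 2≤w)}}))
                                 (cong suc (sym (level-/2 w)))

level-2* : ∀ w → level (2 * suc w) ≡ suc (level (suc w))
level-2* w = ⌊log₂[2*b]⌋≡1+⌊log₂b⌋ (suc w)

level-1+2* : ∀ w → level (suc (2 * suc w)) ≡ suc (level (suc w))
level-1+2* w = trans (level≡1+level-/2 (suc (2 * suc w)) (s≤s (s≤s z≤n))) (cong (λ v → suc (level v)) ([1+2*n]/2≡n (suc w)))

-- Chips per node on each level, counting levels from 0 at the root (the paper's level j + 1).
Profile : Set
Profile = ℕ → ℕ

uniform : Profile → Config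
uniform x zero    = 0
uniform x (suc w) = x (level (suc w))

-- A node on level j + 1 has its parent on level j and two children on level j + 2;
-- the root is its own parent.
levelReceived : Profile → ℕ → ℕ
levelReceived f zero    = f 0 + f 1 + f 1
levelReceived f (suc j) = f j + f (suc (suc j)) + f (suc (suc j))

uniform-pos : ∀ f {w} → 1 ≤ w → uniform f w ≡ f (level w)
uniform-pos f {suc w} _ = refl

received-uniform : ∀ f w → received (uniform f) (suc w) ≡ levelReceived f (level (suc w))
received-uniform f zero    = refl
received-uniform f (suc m) = begin
  uniform f (W / 2) + f (level (2 * W)) + f (level (suc (2 * W)))
    ≡⟨ cong₂ _+_ (cong₂ _+_ (uniform-pos f (m≥n⇒m/n>0 {W} {2} (s≤s (s≤s z≤n))))
                            (cong f (level-2* (suc m))))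
                 (cong f (level-1+2* (suc m))) ⟩
  f (level (W / 2)) + f (suc (level W)) + f (suc (level W))
    ≡⟨ cong (λ j → f (level (W / 2)) + f (suc j) + f (suc j)) (level≡1+level-/2 W (s≤s (s≤s z≤n))) ⟩
  levelReceived f (suc (level (W / 2)))
    ≡⟨ cong (levelReceived f) (level≡1+level-/2 W (s≤s (s≤s z≤n))) ⟨
  levelReceived f (level W) ∎
  where
  open ≡-Reasoning
  W = suc (suc m)

children : List ℕ → List ℕ
children []      = []
children (u ∷ L) = 2 * u ∷ suc (2 * u) ∷ children L

levelNodes : ℕ → List ℕ
levelNodes zero    = 1 ∷ []
levelNodes (suc k) = children (levelNodes k)

multiplicity-children : ∀ L v → multiplicity (children L) v ≡ multiplicity L (v / 2)
multiplicity-children []      v = refl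
multiplicity-children (u ∷ L) v = begin
  [ v ≟' 2 * u ] + ([ v ≟' suc (2 * u) ] + multiplicity (children L) v)
    ≡⟨ +-assoc [ v ≟' 2 * u ] _ _ ⟨
  [ v ≟' 2 * u ] + [ v ≟' suc (2 * u) ] + multiplicity (children L) v
    ≡⟨ cong₂ _+_ (sym (ind-/2 v u)) (multiplicity-children L v) ⟩
  [ v / 2 ≟' u ] + multiplicity L (v / 2) ∎
  where open ≡-Reasoning

onLevel : ℕ → Config
onLevel k = uniform (λ j → [ j ≟' k ])

onLevel-/2 : ∀ k v → onLevel k (v / 2) ≡ onLevel (suc k) v
onLevel-/2 k zero          = refl
onLevel-/2 k (suc zero)    = refl
onLevel-/2 k (suc (suc v)) = begin
  onLevel k (W / 2)                 ≡⟨ uniform-pos _ (m≥n⇒m/n>0 {W} {2} (s≤s (s≤s z≤n))) ⟩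
  [ level (W / 2) ≟' k ]            ≡⟨ ind-suc (level (W / 2)) k ⟨
  [ suc (level (W / 2)) ≟' suc k ]  ≡⟨ cong (λ j → [ j ≟' suc k ]) (level≡1+level-/2 W (s≤s (s≤s z≤n))) ⟨
  [ level W ≟' suc k ]              ∎
  where
  open ≡-Reasoning
  W = suc (suc v)

multiplicity-levelNodes : ∀ k → multiplicity (levelNodes k) ≗ onLevel k
multiplicity-levelNodes zero zero          = refl
multiplicity-levelNodes zero (suc zero)    = refl
multiplicity-levelNodes zero (suc (suc v)) =
  cong (λ j → [ j ≟' 0 ]) (sym (level≡1+level-/2 (suc (suc v)) (s≤s (s≤s z≤n))))
multiplicity-levelNodes (suc k) v = begin
  multiplicity (children (levelNodes k)) v ≡⟨ multiplicity-children (levelNodes k) v ⟩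
  multiplicity (levelNodes k) (v / 2)      ≡⟨ multiplicity-levelNodes k (v / 2) ⟩
  onLevel k (v / 2)                        ≡⟨ onLevel-/2 k v ⟩
  onLevel (suc k) v                        ∎
  where open ≡-Reasoning

FireLevel : ℕ → Profile → Profile → Set
FireLevel k x y = 3 ≤ x k × (∀ j → y j + 3 * [ j ≟' k ] ≡ x j + levelReceived (λ i → [ i ≟' k ]) j)

fire-level : ∀ {k x y} → FireLevel k x y → uniform x ↠ uniform y
fire-level {k} {x} {y} (3≤xk , fired) =
  fire-distinct (levelNodes k) (multiplicity-levelNodes k 0) distinct loaded odometer
  where
  nodes≗ : multiplicity (levelNodes k) ≗ onLevel k
  nodes≗ = multiplicity-levelNodes k
  distinct : ∀ v → multiplicity (levelNodes k) v ≤ 1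
  distinct zero    = subst (_≤ 1) (sym (nodes≗ zero)) z≤n
  distinct (suc v) = subst (_≤ 1) (sym (nodes≗ (suc v))) (ind≤1 _ _)
  loaded : ∀ v → 1 ≤ multiplicity (levelNodes k) v → 3 ≤ uniform x v
  loaded zero    v∈nodes with () ← subst (1 ≤_) (nodes≗ zero) v∈nodes
  loaded (suc v) v∈nodes = subst (λ j → 3 ≤ x j) (sym (ind>0⇒≡ (subst (1 ≤_) (nodes≗ (suc v)) v∈nodes))) 3≤xk
  odometer : Odometer (uniform x) (multiplicity (levelNodes k)) (uniform y)
  odometer zero    = trans (cong (3 *_) (nodes≗ zero)) (sym (received-cong nodes≗ zero))
  odometer (suc w) = begin
    y (level (suc w)) + 3 * multiplicity (levelNodes k) (suc w)
      ≡⟨ cong (λ m → y (level (suc w)) + 3 * m) (nodes≗ (suc w)) ⟩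
    y (level (suc w)) + 3 * [ level (suc w) ≟' k ]
      ≡⟨ fired (level (suc w)) ⟩
    x (level (suc w)) + levelReceived (λ i → [ i ≟' k ]) (level (suc w))
      ≡⟨ cong (x (level (suc w)) +_) (received-uniform _ w) ⟨
    x (level (suc w)) + received (onLevel k) (suc w)
      ≡⟨ cong (x (level (suc w)) +_) (received-cong nodes≗ (suc w)) ⟨
    x (level (suc w)) + received (multiplicity (levelNodes k)) (suc w) ∎
    where open ≡-Reasoning

-- The binary counter

infixr 5 _∷ₚ_
_∷ₚ_ : ℕ → Profile → Profile
(a ∷ₚ x) zero    = a
(a ∷ₚ x) (suc j) = x j

data InnerFiring : Profile → Profile → Set where
  here  : ∀ {a b c r} → 3 ≤ b → InnerFiring (a ∷ₚ b ∷ₚ c ∷ₚ r) (2 + a ∷ₚ b ∸ 3 ∷ₚ suc c ∷ₚ r)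
  there : ∀ {a x y} → InnerFiring x y → InnerFiring (a ∷ₚ x) (a ∷ₚ y)

data Move : Profile → Profile → Set where
  root    : ∀ {a b r} → 3 ≤ a → Move (a ∷ₚ b ∷ₚ r) (a ∸ 2 ∷ₚ suc b ∷ₚ r)
  inner   : ∀ {x y} → InnerFiring x y → Move x y
  relabel : ∀ {x y} → x ≗ y → Move x y

levelReceived-shift : ∀ k j → levelReceived (λ i → [ i ≟' suc (suc k) ]) (suc j)
                            ≡ levelReceived (λ i → [ i ≟' suc k ]) j
levelReceived-shift k zero    = cong (λ m → m + m) (ind-suc 1 (suc k))
levelReceived-shift k (suc j) =
  cong₂ _+_ (cong₂ _+_ (ind-suc j (suc k)) (ind-suc (suc (suc j)) (suc k))) (ind-suc (suc (suc j)) (suc k))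

root-fires-level : ∀ {a b r} → 3 ≤ a → FireLevel 0 (a ∷ₚ b ∷ₚ r) (a ∸ 2 ∷ₚ suc b ∷ₚ r)
root-fires-level {a} {b} {r} 3≤a = 3≤a , fired
  where
  fired : ∀ j → (a ∸ 2 ∷ₚ suc b ∷ₚ r) j + 3 * [ j ≟' 0 ]
              ≡ (a ∷ₚ b ∷ₚ r) j + levelReceived (λ i → [ i ≟' 0 ]) j
  fired zero          = trans (+-suc (a ∸ 2) 2) (trans (cong suc (m∸n+n≡m (≤-trans (s≤s (s≤s z≤n)) 3≤a))) (+-comm 1 a))
  fired (suc zero)    = trans (+-identityʳ (suc b)) (+-comm 1 b)
  fired (suc (suc j)) = refl

inner-fires-level : ∀ {x y} → InnerFiring x y → Σ ℕ λ k → FireLevel (suc k) x y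
inner-fires-level (here {a} {b} {c} {r} 3≤b) = 0 , 3≤b , fired
  where
  fired : ∀ j → (2 + a ∷ₚ b ∸ 3 ∷ₚ suc c ∷ₚ r) j + 3 * [ j ≟' 1 ]
              ≡ (a ∷ₚ b ∷ₚ c ∷ₚ r) j + levelReceived (λ i → [ i ≟' 1 ]) j
  fired zero                = trans (+-identityʳ (2 + a)) (+-comm 2 a)
  fired (suc zero)          = trans (m∸n+n≡m 3≤b) (sym (+-identityʳ b))
  fired (suc (suc zero))    = trans (+-identityʳ (suc c)) (+-comm 1 c)
  fired (suc (suc (suc j))) = refl
inner-fires-level (there {a} {x} {y} φ) with inner-fires-level φ
... | k , 3≤xk , fired = suc k , 3≤xk , fired′
  where
  fired′ : ∀ j → (a ∷ₚ y) j + 3 * [ j ≟' suc (suc k) ]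
               ≡ (a ∷ₚ x) j + levelReceived (λ i → [ i ≟' suc (suc k) ]) j
  fired′ zero    = refl
  fired′ (suc j) = begin
    y j + 3 * [ suc j ≟' suc (suc k) ] ≡⟨ cong (λ m → y j + 3 * m) (ind-suc j (suc k)) ⟩
    y j + 3 * [ j ≟' suc k ]           ≡⟨ fired j ⟩
    x j + levelReceived (λ i → [ i ≟' suc k ]) j ≡⟨ cong (x j +_) (levelReceived-shift k j) ⟨
    x j + levelReceived (λ i → [ i ≟' suc (suc k) ]) (suc j) ∎
    where open ≡-Reasoning

uniform-cong : ∀ {x y} → x ≗ y → uniform x ≗ uniform y
uniform-cong x≗y zero    = refl
uniform-cong x≗y (suc w) = x≗y (level (suc w))

move-↠ : ∀ {x y} → Move x y → uniform x ↠ uniform y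
move-↠ (root 3≤a)    = fire-level (root-fires-level 3≤a)
move-↠ (inner φ)     with inner-fires-level φ
... | _ , fires      = fire-level fires
move-↠ (relabel x≗y) = ↠-reflexive (uniform-cong x≗y)

moves-↠ : ∀ {x y} → Star Move x y → uniform x ↠ uniform y
moves-↠ ε              = ↠-reflexive (λ _ → refl)
moves-↠ (move ◅ moves) = ↠-trans (move-↠ move) (moves-↠ moves)

ones : ℕ → Profile → Profile
ones zero    x = x
ones (suc k) x = ones k (1 ∷ₚ x)

ones-inner : ∀ k {x y} → InnerFiring x y → InnerFiring (ones k x) (ones k y)
ones-inner zero    φ = φ
ones-inner (suc k) φ = ones-inner k (there φ)

∷ₚ-cong : ∀ a {x y} → x ≗ y → a ∷ₚ x ≗ a ∷ₚ y
∷ₚ-cong a x≗y zero    = refl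
∷ₚ-cong a x≗y (suc j) = x≗y j

ones-cong : ∀ k {x y} → x ≗ y → ones k x ≗ ones k y
ones-cong zero    x≗y = x≗y
ones-cong (suc k) x≗y = ones-cong k (∷ₚ-cong 1 x≗y)

-- Levels 0, …, k − 1 hold one chip per node and level k holds 3: level k fires, and the two
-- chips per node it sends to level k − 1 make that level fire in turn, and so on up to the root.
carry : ∀ k a r → Star Move (ones k (3 ∷ₚ a ∷ₚ r)) (ones (suc k) (suc a ∷ₚ r))
carry zero    a r = root (s≤s (s≤s (s≤s z≤n))) ◅ ε
carry (suc k) a r = inner (ones-inner k (here (s≤s (s≤s (s≤s z≤n))))) ◅ carry k 0 (suc a ∷ₚ r)

digit : ℕ → ℕ
digit zero          = 0
digit (suc zero)    = 0
digit (suc (suc m)) = suc (suc (suc m) % 2)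

-- The terminal profile for M − 1 chips at the root: level j holds 1 + bit j of M chips per node
-- when 2 ^ (j + 1) ≤ M, and none otherwise.
counter : ℕ → Profile
counter M zero    = digit M
counter M (suc j) = counter (M / 2) j

counter-∷ₚ : ∀ M → counter M ≗ digit M ∷ₚ counter (M / 2)
counter-∷ₚ M zero    = refl
counter-∷ₚ M (suc j) = refl

counter-0 : ∀ j → counter 0 j ≡ 0
counter-0 zero    = refl
counter-0 (suc j) = counter-0 j

counter-1 : ∀ j → counter 1 j ≡ 0
counter-1 zero    = refl
counter-1 (suc j) = counter-0 j

digit-≥2 : ∀ {M} → 2 ≤ M → digit M ≡ suc (M % 2)
digit-≥2 {suc (suc m)} _ = refl
digit-≥2 {suc zero} (s≤s ())

digit-even : ∀ q → digit (2 * suc q) ≡ 1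
digit-even q = trans (digit-≥2 (*-monoʳ-≤ 2 {1} {suc q} (s≤s z≤n)))
                     (cong suc (trans (cong (_% 2) (*-comm 2 (suc q))) (m*n%n≡0 (suc q) 2)))

digit-odd : ∀ q → digit (suc (2 * suc q)) ≡ 2
digit-odd q = trans (digit-≥2 (m≤n⇒m≤1+n (*-monoʳ-≤ 2 {1} {suc q} (s≤s z≤n))))
                    (cong suc (trans (cong (λ m → suc m % 2) (*-comm 2 (suc q))) ([m+kn]%n≡m%n 1 (suc q) 2)))

-- Incrementing the counter from level k on; ones k records the levels the carry has passed.
add-chip : ∀ k M → 1 ≤ M → Acc _<_ M →
  Star Move (ones k (suc (digit M) ∷ₚ counter (M / 2))) (ones k (counter (suc M)))
add-chip k M 1≤M (acc smaller) with evenOdd M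
add-chip k .(2 * zero) () _ | even zero
add-chip k .(2 * suc q) _ _ | even (suc q) = relabel (ones-cong k no-carry) ◅ ε
  where
  no-carry : suc (digit (2 * suc q)) ∷ₚ counter (2 * suc q / 2) ≗ counter (suc (2 * suc q))
  no-carry zero    = trans (cong suc (digit-even q)) (sym (digit-odd q))
  no-carry (suc j) = cong (λ m → counter m j) (trans ([2*n]/2≡n (suc q)) (sym ([1+2*n]/2≡n (suc q))))
add-chip k .(suc (2 * zero)) _ _ | odd zero = relabel (ones-cong k no-carry) ◅ ε
  where
  no-carry : 1 ∷ₚ counter 0 ≗ counter 2
  no-carry zero    = refl
  no-carry (suc j) = trans (counter-0 j) (sym (counter-1 j))
add-chip k .(suc (2 * suc q)) _ (acc smaller) | odd (suc q) =
  relabel (ones-cong k before-carry) ◅ carry k (digit p) (counter (p / 2))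
  ◅◅ add-chip (suc k) p (s≤s z≤n) (smaller p<M)
  ◅◅ relabel (ones-cong k after-carry) ◅ ε
  where
  p M : ℕ
  p = suc q
  M = suc (2 * p)
  p<M : p < M
  p<M = s≤s (m≤n*m p 2)
  before-carry : suc (digit M) ∷ₚ counter (M / 2) ≗ 3 ∷ₚ digit p ∷ₚ counter (p / 2)
  before-carry zero    = cong suc (digit-odd q)
  before-carry (suc j) = trans (cong (λ m → counter m j) ([1+2*n]/2≡n p)) (counter-∷ₚ p j)
  after-carry : 1 ∷ₚ counter (suc p) ≗ counter (suc M)
  after-carry zero    = sym (trans (cong digit (sym (*-suc 2 p))) (digit-even p))
  after-carry (suc j) = cong (λ m → counter m j) (sym (trans ([2+n]/2≡1+n/2 (2 * p)) (cong suc ([2*n]/2≡n p))))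

atRoot-suc : ∀ N → atRoot (suc N) ≗ atRoot N ⊕ atRoot 1
atRoot-suc N w = trans (*-suc [ w ≟' 1 ] N) (trans (+-comm [ w ≟' 1 ] _) (cong (atRoot N w +_) (sym (*-identityʳ _))))

add-chip-at-root : ∀ M → uniform (counter M) ⊕ atRoot 1 ≗ uniform (suc (digit M) ∷ₚ counter (M / 2))
add-chip-at-root M zero          = refl
add-chip-at-root M (suc zero)    = +-comm (digit M) 1
add-chip-at-root M (suc (suc w)) = trans (+-identityʳ _) (above-root (⌊log₂⌋-mono-≤ {2} {suc (suc w)} (s≤s (s≤s z≤n))))
  where
  above-root : ∀ {j} → 1 ≤ j → counter M j ≡ (suc (digit M) ∷ₚ counter (M / 2)) j
  above-root {suc j} _ = refl

atRoot-↠-counter : ∀ N → atRoot N ↠ uniform (counter (suc N))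
atRoot-↠-counter zero    = ↠-reflexive λ where
  zero    → refl
  (suc w) → trans (*-zeroʳ [ suc w ≟' 1 ]) (sym (counter-1 (level (suc w))))
atRoot-↠-counter (suc N) =
  ↠-trans (↠-reflexive (atRoot-suc N))
  (↠-trans (↠-⊕ (atRoot 1) (atRoot-↠-counter N))
  (↠-trans (↠-reflexive (add-chip-at-root (suc N)))
           (moves-↠ (add-chip 0 (suc N) (s≤s z≤n) (<-wellFounded (suc N))))))

digit≤2 : ∀ M → digit M ≤ 2
digit≤2 zero          = z≤n
digit≤2 (suc zero)    = z≤n
digit≤2 (suc (suc m)) = m%n<n (suc (suc m)) 2

counter≤2 : ∀ M j → counter M j ≤ 2
counter≤2 M zero    = digit≤2 M
counter≤2 M (suc j) = counter≤2 (M / 2) j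

counter-terminal : ∀ M → Terminal (uniform (counter M))
counter-terminal M zero    ()
counter-terminal M (suc w) _ = s≤s (counter≤2 M (level (suc w)))

counter≡bit+1 : ∀ M i → 2 ^ suc i ≤ M → counter M i ≡ bit M i + 1
counter≡bit+1 M zero    2≤M = trans (digit-≥2 2≤M) (+-comm 1 (M % 2))
counter≡bit+1 M (suc i) 2^[2+i]≤M =
  counter≡bit+1 (M / 2) i (subst (_≤ M / 2) ([2*n]/2≡n (2 ^ suc i)) (/-monoˡ-≤ 2 2^[2+i]≤M))

level-< : ∀ i w → w < 2 ^ suc i → level w ≤ i
level-< i       zero          _ = z≤n
level-< i       (suc zero)    _ = z≤n
level-< zero    (suc (suc w)) (s≤s (s≤s ()))
level-< (suc i) (suc (suc w)) W<2^[2+i] = begin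
  level W             ≡⟨ level≡1+level-/2 W (s≤s (s≤s z≤n)) ⟩
  suc (level (W / 2)) ≤⟨ s≤s (level-< i (W / 2) (m<n*o⇒m/o<n (subst (W <_) (*-comm 2 (2 ^ suc i)) W<2^[2+i]))) ⟩
  suc i               ∎
  where
  open ≤-Reasoning
  W = suc (suc w)

level-onLevelSuc : ∀ i {w} → OnLevelSuc i w → level w ≡ i
level-onLevelSuc i {w} (2^i≤w , w<2^[1+i]) =
  ≤-antisym (level-< i w w<2^[1+i]) (subst (_≤ level w) (⌊log₂[2^n]⌋≡n i) (⌊log₂⌋-mono-≤ 2^i≤w))

uniform-onLevelSuc : ∀ x i {w} → OnLevelSuc i w → uniform x w ≡ x i
uniform-onLevelSuc x i w∈level@(2^i≤w , _) =
  trans (uniform-pos x (≤-trans (m^n>0 2 i) 2^i≤w)) (cong x (level-onLevelSuc i w∈level))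

corollary3p4 : (n N : ℕ) → 1 ≤ n → 2 ^ n ∸ 1 ≤ N → N ≤ 2 ^ suc n ∸ 2 →
    Σ Config (λ c → Reach (atRoot N) c × Terminal c)
    × (∀ c → Reach (atRoot N) c → Terminal c →
         ∀ i → i < n → ∀ w → OnLevelSuc i w → c w ≡ bit (N + 1) i + 1)
corollary3p4 n N _ 2^n∸1≤N _ with atRoot-↠-counter N
... | t , reach , t≗counter = (t , reach , t-terminal) , levels
  where
  t-terminal : Terminal t
  t-terminal w 1≤w = subst (_< 3) (sym (t≗counter w)) (counter-terminal (suc N) w 1≤w)
  2^n≤1+N : 2 ^ n ≤ suc N
  2^n≤1+N = ≤-trans (m≤n+m∸n (2 ^ n) 1) (s≤s 2^n∸1≤N)
  levels : ∀ c → Reach (atRoot N) c → Terminal c →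
    ∀ i → i < n → ∀ w → OnLevelSuc i w → c w ≡ bit (N + 1) i + 1
  levels c reach-c c-terminal i i<n w w∈level = begin
    c w                         ≡⟨ terminal-unique reach-c c-terminal reach t-terminal w ⟩
    t w                         ≡⟨ t≗counter w ⟩
    uniform (counter (suc N)) w ≡⟨ uniform-onLevelSuc (counter (suc N)) i w∈level ⟩
    counter (suc N) i           ≡⟨ counter≡bit+1 (suc N) i (≤-trans (^-monoʳ-≤ 2 {suc i} {n} i<n) 2^n≤1+N) ⟩
    bit (suc N) i + 1           ≡⟨ cong (λ M → bit M i + 1) (+-comm 1 N) ⟩
    bit (N + 1) i + 1           ∎
    where open ≡-Reasoning
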